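{- For integers $m,n\ge 2$ (with $m\ge 3$ whenever $C_m$ appears and $n\ge 3$ whenever $C_n$ appears), where $T_k$ denotes an arbitrary tree of order $k$, it holds that: 1. $C_{cc}(K_m\Box K_n)=\max\{m,n\}$; 2. $C_{cc}(K_m\Box C_n)=\max\{n,\ m(n-2)\}$; 3. $C_{cc}(K_m\Box T_n)=\max\{n,\ m(n-1)\}$; 4. $C_{cc}(C_m\Box C_n)=\max\{mn-2n,\ mn-2m\}$; 5. $C_{cc}(C_m\Box T_n)=\max\{mn-2n,\ mn-m\}$; 6. $C_{cc}(T_m\Box T_n)=\max\{mn-n,\ mn-m\}$.
   Context: All graphs are finite, simple and undirected. Cycle convexity on a graph $G$: for $S\subseteq V(G)$, the cycle interval $\langle S\rangle$ is $S$ together with every vertex $w\in V(G)$ that lies on a cycle of the induced subgraph $G[S\cup\{w\}]$ passing through $w$. $S$ is (cycle) convex if $\langle S\rangle=S$. The cycle convexity number $C_{cc}(G)$ is the maximum cardinality of a proper (i.e. $\neq V(G)$) convex subset of $V(G)$. The Cartesian product $G\Box H$ has vertex set $V(G)\times V(H)$, with $(g_1,h_1)\sim(g_2,h_2)$ iff ($g_1\sim g_2$ and $h_1=h_2$) or ($g_1=g_2$ and $h_1\sim h_2$). $K_k$, $C_k$ denote the complete graph and cycle on $k$ vertices. -}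

module Defs where

open import Data.Nat using (ℕ; zero; suc; _+_; _≤_; s≤s; z≤n)
open import Data.Nat.Properties using (suc-injective)
import Data.Nat.Properties as ℕₚ
open import Data.Fin using (Fin; zero; suc; toℕ; inject₁; fromℕ; remQuot; _≟_)
open import Data.Fin.Subset using (Subset; _∈_; ⊤; ∣_∣)
open import Data.Product using (Σ; ∃; _×_; _,_; proj₁; proj₂)
open import Data.Sum using (_⊎_; inj₁; inj₂)
open import Data.Empty using (⊥)
open import Relation.Nullary using (¬_; Dec; yes; no)
open import Relation.Nullary.Decidable using (_×-dec_; _⊎-dec_; ¬?)
open import Relation.Binary.PropositionalEquality using (_≡_; _≢_; refl; sym; trans; cong)

record Graph (n : ℕ) : Set₁ where
  field
    Adj    : Fin n → Fin n → Set
    adjSym : ∀ {x y} → Adj x y → Adj y x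
    irrefl : ∀ {x} → ¬ Adj x x
    adj?   : ∀ x y → Dec (Adj x y)
open Graph public

-- Cycles: a cyclic sequence v₀ v₁ … v_{k+2} (length k+3 ≥ 3) of pairwise
-- distinct vertices with vᵢ ~ vᵢ₊₁ and v_{k+2} ~ v₀.

record Cycle {n : ℕ} (G : Graph n) : Set where
  field
    k       : ℕ
    vs      : Fin (suc (suc (suc k))) → Fin n
    inj     : ∀ i j → vs i ≡ vs j → i ≡ j
    steps   : ∀ (i : Fin (suc (suc k))) → Adj G (vs (inject₁ i)) (vs (suc i))
    closing : Adj G (vs (fromℕ (suc (suc k)))) (vs zero)
open Cycle public

-- A cycle of the induced subgraph G[S ∪ {w}] passing through w
-- (w is taken as the starting vertex v₀ of the cyclic sequence).
record CycleThrough {n : ℕ} (G : Graph n) (S : Subset n) (w : Fin n) : Set where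
  field
    cyc     : Cycle G
    inside  : ∀ i → (vs cyc i ∈ S) ⊎ (vs cyc i ≡ w)
    through : vs cyc zero ≡ w
open CycleThrough public

_∈⟨_⟩_ : ∀ {n} → Fin n → Subset n → Graph n → Set
w ∈⟨ S ⟩ G = (w ∈ S) ⊎ CycleThrough G S w

-- S is cycle-convex: ⟨S⟩ = S  (S ⊆ ⟨S⟩ always holds)
Convex : ∀ {n} → Graph n → Subset n → Set
Convex G S = ∀ w → w ∈⟨ S ⟩ G → w ∈ S

IsCcc : ∀ {n} → Graph n → ℕ → Set
IsCcc {n} G c =
  (Σ (Subset n) λ S → Convex G S × S ≢ ⊤ × ∣ S ∣ ≡ c)
  × (∀ (S : Subset n) → Convex G S → S ≢ ⊤ → ∣ S ∣ ≤ c)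

data Walk {n : ℕ} (G : Graph n) : Fin n → Fin n → Set where
  here : ∀ {x} → Walk G x x
  step : ∀ {x y z} → Adj G x y → Walk G y z → Walk G x z

Connected : ∀ {n} → Graph n → Set
Connected G = ∀ x y → Walk G x y

IsTree : ∀ {n} → Graph n → Set
IsTree G = Connected G × ¬ Cycle G

K : (m : ℕ) → Graph m
K m = record
  { Adj    = λ x y → x ≢ y
  ; adjSym = λ x≢y y≡x → x≢y (sym y≡x)
  ; irrefl = λ x≢x → x≢x refl
  ; adj?   = λ x y → ¬? (x ≟ y)
  }

CycAdj : (m : ℕ) → Fin m → Fin m → Set
CycAdj m x y =
  (suc (toℕ x) ≡ toℕ y) ⊎ (suc (toℕ y) ≡ toℕ x)
  ⊎ ((toℕ x ≡ 0 × suc (toℕ y) ≡ m) ⊎ (toℕ y ≡ 0 × suc (toℕ x) ≡ m))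

private
  n≢1+n : ∀ (a : ℕ) → suc a ≢ a
  n≢1+n zero ()
  n≢1+n (suc a) e = n≢1+n a (suc-injective e)

  bad : ∀ (a m : ℕ) → a ≡ 0 → suc a ≡ m → 3 ≤ m → ⊥
  bad .0 .1 refl refl (s≤s ())

  cycIrrefl : ∀ m → 3 ≤ m → ∀ {x : Fin m} → ¬ CycAdj m x x
  cycIrrefl m _ (inj₁ e) = n≢1+n _ e
  cycIrrefl m _ (inj₂ (inj₁ e)) = n≢1+n _ e
  cycIrrefl m h {x} (inj₂ (inj₂ (inj₁ (x0 , e)))) = bad (toℕ x) m x0 e h
  cycIrrefl m h {x} (inj₂ (inj₂ (inj₂ (x0 , e)))) = bad (toℕ x) m x0 e h

  cycSym : ∀ m {x y : Fin m} → CycAdj m x y → CycAdj m y x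
  cycSym m (inj₁ e) = inj₂ (inj₁ e)
  cycSym m (inj₂ (inj₁ e)) = inj₁ e
  cycSym m (inj₂ (inj₂ (inj₁ p))) = inj₂ (inj₂ (inj₂ p))
  cycSym m (inj₂ (inj₂ (inj₂ p))) = inj₂ (inj₂ (inj₁ p))

Cyc : (m : ℕ) → 3 ≤ m → Graph m
Cyc m m≥3 = record
  { Adj    = CycAdj m
  ; adjSym = cycSym m
  ; irrefl = cycIrrefl m m≥3
  ; adj?   = λ x y →
      (suc (toℕ x) ℕₚ.≟ toℕ y) ⊎-dec (suc (toℕ y) ℕₚ.≟ toℕ x)
      ⊎-dec (((toℕ x ℕₚ.≟ 0) ×-dec (suc (toℕ y) ℕₚ.≟ m))
             ⊎-dec ((toℕ y ℕₚ.≟ 0) ×-dec (suc (toℕ x) ℕₚ.≟ m)))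
  }

-- Cartesian product G □ H on Fin (m * n); vertex v ↔ remQuot {m} n v ∈ Fin m × Fin n

ProdAdj : ∀ {m n} → Graph m → Graph n → Fin (m Data.Nat.* n) → Fin (m Data.Nat.* n) → Set
ProdAdj {m} {n} G H u v =
  (Adj G (proj₁ (remQuot {m} n u)) (proj₁ (remQuot {m} n v)) × proj₂ (remQuot {m} n u) ≡ proj₂ (remQuot {m} n v))
  ⊎ (proj₁ (remQuot {m} n u) ≡ proj₁ (remQuot {m} n v) × Adj H (proj₂ (remQuot {m} n u)) (proj₂ (remQuot {m} n v)))

infixl 7 _□_
_□_ : ∀ {m n} → Graph m → Graph n → Graph (m Data.Nat.* n)
_□_ {m} {n} G H = record
  { Adj    = ProdAdj G H
  ; adjSym = λ { (inj₁ (a , e)) → inj₁ (adjSym G a , sym e)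
               ; (inj₂ (e , a)) → inj₂ (sym e , adjSym H a) }
  ; irrefl = λ { (inj₁ (a , _)) → irrefl G a ; (inj₂ (_ , a)) → irrefl H a }
  ; adj?   = λ u v →
      (adj? G (proj₁ (remQuot {m} n u)) (proj₁ (remQuot {m} n v)) ×-dec (proj₂ (remQuot {m} n u) ≟ proj₂ (remQuot {m} n v)))
      ⊎-dec ((proj₁ (remQuot {m} n u) ≟ proj₁ (remQuot {m} n v)) ×-dec adj? H (proj₂ (remQuot {m} n u)) (proj₂ (remQuot {m} n v)))
  }

-- For connected G and H, a proper convex S ⊆ G □ H cannot contain both a
-- full G-fibre and a full H-fibre: starting from such a cross, the 4-cycles
-- (x′,y′)(x′,y)(x,y)(x,y′) of the product, followed along walks in G and H,
-- force every vertex into S.  So all G-fibres of S, or all H-fibres, are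
-- proper convex sets of the factor, whence
-- C_cc(G □ H) ≤ max(|H| C_cc(G), |G| C_cc(H)).
-- Conversely, a set in which every outside vertex has at most one neighbour
-- is convex, and this property, unlike convexity, passes from A to A × V(H)
-- and V(G) × A.  For K_m, C_m and trees an extremal set of this kind exists:
-- a vertex, the path C_m − {0,1}, and the complement of a leaf.  Their sizes
-- 1, m − 2 and m − 1 are optimal: a larger proper set is closed by a
-- triangle, by the cycle itself, resp. is not proper.
module Submission where

open import Data.Bool using (Bool; true; false)
open import Data.Empty using (⊥-elim)
open import Data.Fin using (Fin; zero; suc; toℕ; inject₁; inject≤; fromℕ; fromℕ<; _↑ˡ_; _↑ʳ_;
  combine; remQuot; quotient; remainder; _≟_)
open import Data.Fin.Properties using (toℕ-injective; toℕ<n; toℕ-fromℕ; toℕ-fromℕ<; toℕ-inject₁;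
  toℕ-inject≤; inject≤-injective; injective⇒≤; remQuot-combine; combine-remQuot;
  combine-injectiveˡ; combine-injectiveʳ; any?; all?; ¬∀⟶∃¬)
open import Data.Fin.Subset using (Subset; _∈_; _∉_; ⊤; ∣_∣; ⁅_⁆; ∁; _-_; outside)
open import Data.Fin.Subset.Properties using (_∈?_; ∈⊤; ⊆⊤; ⊆-antisym; ∣⊤∣≡n; ∣⊥∣≡0;
  p⊂q⇒∣p∣<∣q∣; p⊆q⇒∣p∣≤∣q∣; x∈p∧x≢y⇒x∈p-y; x∈p⇒∣p-x∣<∣p∣; x∈⁅x⁆; x∈⁅y⁆⇒x≡y; ∣⁅x⁆∣≡1;
  ∣∁p∣≡n∸∣p∣; x∉∁p⇒x∈p; x∈p⇒x∉∁p; nonempty?; Empty-unique)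
open import Data.Nat using (ℕ; zero; suc; _+_; _*_; _∸_; _≤_; _<_; _⊔_; z≤n; s≤s; _%_)
open import Data.Nat.DivMod using (m%n<n; m<n⇒m%n≡m; n%n≡0; [m+n]%n≡m%n; %-distribˡ-+; m%n%n≡m%n)
open import Data.Nat.Properties using (+-0-commutativeMonoid; suc-injective; +-assoc; +-comm; +-suc;
  +-identityʳ; *-comm; *-identityʳ; *-identityˡ; *-distribˡ-∸; *-distribʳ-∸; +-mono-≤; ≤-trans;
  ≤-reflexive; <⇒≤; n≤1+n; 1+n≰n; m≤m⊔n; m≤n⊔m; module ≤-Reasoning; ⊔-comm; ⊔-sel; m≤n⇒m<n∨m≡n;
  m+[n∸m]≡n; ∸-monoˡ-≤)
open import Algebra.Properties.CommutativeMonoid.Sum +-0-commutativeMonoid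
  using (sum-syntax; ∑-comm; sum-cong-≗)
open import Data.Product using (Σ; ∃; _×_; _,_; proj₁; proj₂; uncurry)
open import Data.Product.Properties using (×-≡,≡→≡)
open import Data.Sum using (_⊎_; inj₁; inj₂)
open import Data.Vec using ([]; _∷_; lookup; tabulate; here; there)
open import Data.Vec.Properties using (lookup∘tabulate; []=⇒lookup; lookup⇒[]=)
open import Data.Vec.Relation.Unary.All using ([]; _∷_)
open import Data.Vec.Relation.Unary.AllPairs using ([]; _∷_)
open import Data.Vec.Relation.Unary.Unique.Propositional using (Unique)
open import Data.Vec.Relation.Unary.Unique.Propositional.Properties using (lookup-injective)
open import Function using (_∘_)
open import Relation.Nullary using (¬_; yes; no)
open import Relation.Nullary.Decidable using (_×-dec_; _⊎-dec_; ¬?)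
open import Relation.Binary.PropositionalEquality

open import Defs

private
  variable
    m n L c : ℕ

𝟙 : Bool → ℕ
𝟙 true  = 1
𝟙 false = 0

∑-const : ∀ N c → ∑[ i < N ] c ≡ N * c
∑-const zero    c = refl
∑-const (suc N) c = cong (c +_) (∑-const N c)

∑-bound : ∀ {N c} (f : Fin N → ℕ) → (∀ i → f i ≤ c) → ∑[ i < N ] f i ≤ N * c
∑-bound {zero}  f f≤c = z≤n
∑-bound {suc N} f f≤c = +-mono-≤ (f≤c zero) (∑-bound (f ∘ suc) (f≤c ∘ suc))

∑-↑ : ∀ a b (f : Fin (a + b) → ℕ) →
      ∑[ i < a + b ] f i ≡ ∑[ i < a ] f (i ↑ˡ b) + ∑[ j < b ] f (a ↑ʳ j)
∑-↑ zero    b f = refl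
∑-↑ (suc a) b f = trans (cong (f zero +_) (∑-↑ a b (f ∘ suc))) (sym (+-assoc (f zero) _ _))

∑-combine : ∀ m n (f : Fin (m * n) → ℕ) →
            ∑[ v < m * n ] f v ≡ ∑[ a < m ] ∑[ b < n ] f (combine a b)
∑-combine zero    n f = refl
∑-combine (suc m) n f =
  trans (∑-↑ n (m * n) f) (cong (∑[ b < n ] f (b ↑ˡ m * n) +_) (∑-combine m n (f ∘ (n ↑ʳ_))))

∣p∣≡∑ : (p : Subset n) → ∣ p ∣ ≡ ∑[ i < n ] 𝟙 (lookup p i)
∣p∣≡∑ []          = refl
∣p∣≡∑ (true  ∷ p) = cong suc (∣p∣≡∑ p)
∣p∣≡∑ (false ∷ p) = ∣p∣≡∑ p

∃-∉ : {S : Subset n} → S ≢ ⊤ → ∃ (_∉ S)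
∃-∉ {n} {S} S≢⊤ with all? (_∈? S)
... | yes all∈ = ⊥-elim (S≢⊤ (⊆-antisym ⊆⊤ (λ {x} _ → all∈ x)))
... | no ¬all∈ = ¬∀⟶∃¬ n (_∈ S) (_∈? S) ¬all∈

∉⇒≢⊤ : {S : Subset n} {x : Fin n} → x ∉ S → S ≢ ⊤
∉⇒≢⊤ x∉S refl = x∉S ∈⊤

∉⇒∣p∣<n : {p : Subset n} {x : Fin n} → x ∉ p → ∣ p ∣ < n
∉⇒∣p∣<n {n} {p} x∉p = subst (∣ p ∣ <_) (∣⊤∣≡n n) (p⊂q⇒∣p∣<∣q∣ (⊆⊤ , _ , ∈⊤ , x∉p))

∉∉⇒2+∣p∣≤n : {p : Subset n} {x y : Fin n} → x ≢ y → x ∉ p → y ∉ p → 2 + ∣ p ∣ ≤ n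
∉∉⇒2+∣p∣≤n {n} {p} {x} {y} x≢y x∉p y∉p = ≤-trans (s≤s ∣p∣<∣⊤-y∣) ∣⊤-y∣<n
  where
  ∣p∣<∣⊤-y∣ : ∣ p ∣ < ∣ ⊤ - y ∣
  ∣p∣<∣⊤-y∣ = p⊂q⇒∣p∣<∣q∣ ((λ {z} z∈p → x∈p∧x≢y⇒x∈p-y ∈⊤ λ { refl → y∉p z∈p })
                         , x , x∈p∧x≢y⇒x∈p-y ∈⊤ x≢y , x∉p)
  ∣⊤-y∣<n : ∣ ⊤ - y ∣ < n
  ∣⊤-y∣<n = subst (∣ ⊤ - y ∣ <_) (∣⊤∣≡n n) (x∈p⇒∣p-x∣<∣p∣ {p = ⊤ {n}} (∈⊤ {x = y}))

∣p∣≤1 : {p : Subset n} → (∀ {x y} → x ∈ p → y ∈ p → x ≡ y) → ∣ p ∣ ≤ 1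
∣p∣≤1 {n} {p} unique with nonempty? p
... | yes (x , x∈p) = subst (∣ p ∣ ≤_) (∣⁅x⁆∣≡1 x)
                        (p⊆q⇒∣p∣≤∣q∣ λ y∈p → subst (_∈ ⁅ x ⁆) (unique x∈p y∈p) (x∈⁅x⁆ x))
... | no empty = subst (λ q → ∣ q ∣ ≤ 1) (sym (Empty-unique empty)) (subst (_≤ 1) (sym (∣⊥∣≡0 n)) z≤n)

preimage : (Fin m → Fin n) → Subset n → Subset m
preimage f S = tabulate (λ x → lookup S (f x))

∈-preimage⁺ : ∀ {f : Fin m → Fin n} {S x} → f x ∈ S → x ∈ preimage f S
∈-preimage⁺ {x = x} fx∈S = lookup⇒[]= x _ (trans (lookup∘tabulate _ x) ([]=⇒lookup fx∈S))

∈-preimage⁻ : ∀ {f : Fin m → Fin n} {S x} → x ∈ preimage f S → f x ∈ S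
∈-preimage⁻ {f = f} {S} {x} x∈ = lookup⇒[]= (f x) S (trans (sym (lookup∘tabulate _ x)) ([]=⇒lookup x∈))

∣preimage∣ : ∀ (f : Fin m → Fin n) S → ∣ preimage f S ∣ ≡ ∑[ x < m ] 𝟙 (lookup S (f x))
∣preimage∣ f S = trans (∣p∣≡∑ (preimage f S))
  (sum-cong-≗ (λ x → cong 𝟙 (lookup∘tabulate (λ y → lookup S (f y)) x)))

_◅◅_ : {G : Graph n} {x y z : Fin n} → Walk G x y → Walk G y z → Walk G x z
here       ◅◅ q = q
step xy p  ◅◅ q = step xy (p ◅◅ q)

reverse : {G : Graph n} {x y : Fin n} → Walk G x y → Walk G y x
reverse         here        = here
reverse {G = G} (step xy p) = reverse p ◅◅ step (adjSym G xy) here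

rooted⇒connected : (G : Graph n) (r : Fin n) → (∀ y → Walk G r y) → Connected G
rooted⇒connected G r walk x y = reverse (walk x) ◅◅ walk y

walk-transport : {G : Graph n} (P : Fin n → Set) → (∀ {u v} → Adj G u v → P u → P v) →
                 ∀ {x y} → Walk G x y → P x → P y
walk-transport P closed here        px = px
walk-transport P closed (step xy p) px = walk-transport P closed p (closed xy px)

-- Cycle convexity

Adj⇒≢ : (G : Graph n) {x y : Fin n} → Adj G x y → x ≢ y
Adj⇒≢ G xy refl = irrefl G xy

module _ {G : Graph n} {S : Subset n} where

  cycle-closed : Convex G S → ∀ {w} (c : Cycle G) → vs c zero ≡ w →
                 (∀ i → (vs c i ∈ S) ⊎ (vs c i ≡ w)) → w ∈ S
  cycle-closed convex c starts members =
    convex _ (inj₂ record { cyc = c ; inside = members ; through = starts })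

  triangle-closed : Convex G S → ∀ {w u v} → Unique (w ∷ u ∷ v ∷ []) →
                    Adj G w u → Adj G u v → Adj G v w → u ∈ S → v ∈ S → w ∈ S
  triangle-closed convex {w} {u} {v} distinct wu uv vw u∈S v∈S =
    cycle-closed convex triangle refl members
    where
    triangle : Cycle G
    triangle = record { k = 0 ; vs = lookup (w ∷ u ∷ v ∷ []) ; inj = lookup-injective distinct
                      ; steps = λ { zero → wu ; (suc zero) → uv } ; closing = vw }
    members : ∀ i → (vs triangle i ∈ S) ⊎ (vs triangle i ≡ w)
    members zero             = inj₂ refl
    members (suc zero)       = inj₁ u∈S
    members (suc (suc zero)) = inj₁ v∈S

  square-closed : Convex G S → ∀ {w p q r} → Unique (w ∷ p ∷ q ∷ r ∷ []) →
                  Adj G w p → Adj G p q → Adj G q r → Adj G r w → p ∈ S → q ∈ S → r ∈ S → w ∈ S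
  square-closed convex {w} {p} {q} {r} distinct wp pq qr rw p∈S q∈S r∈S =
    cycle-closed convex square refl members
    where
    square : Cycle G
    square = record { k = 1 ; vs = lookup (w ∷ p ∷ q ∷ r ∷ []) ; inj = lookup-injective distinct
                    ; steps = λ { zero → wp ; (suc zero) → pq ; (suc (suc zero)) → qr } ; closing = rw }
    members : ∀ i → (vs square i ∈ S) ⊎ (vs square i ≡ w)
    members zero                   = inj₂ refl
    members (suc zero)             = inj₁ p∈S
    members (suc (suc zero))       = inj₁ q∈S
    members (suc (suc (suc zero))) = inj₁ r∈S

AtMostOneNeighbour : Graph n → Subset n → Set
AtMostOneNeighbour G A = ∀ {w u v} → w ∉ A → u ∈ A → v ∈ A → Adj G w u → Adj G w v → u ≡ v

-- The two neighbours of w on a cycle through w would be distinct vertices of A.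
atMostOneNeighbour⇒convex : {G : Graph n} {A : Subset n} → AtMostOneNeighbour G A → Convex G A
atMostOneNeighbour⇒convex one w (inj₁ w∈A) = w∈A
atMostOneNeighbour⇒convex {G = G} {A} one w (inj₂ ct) with w ∈? A
... | yes w∈A = w∈A
... | no  w∉A = ⊥-elim (second≢last (inj C _ _ (one w∉A (other (suc zero) λ ()) (other last λ ())
                                     (from-w (steps C zero)) (from-w (adjSym G (closing C))))))
  where
  C : Cycle G
  C = cyc ct
  last : Fin (3 + k C)
  last = fromℕ (suc (suc (k C)))
  second≢last : suc zero ≢ last
  second≢last ()
  from-w : ∀ {u} → Adj G (vs C zero) u → Adj G w u
  from-w = subst (λ x → Adj G x _) (through ct)
  other : ∀ i → i ≢ zero → vs C i ∈ A
  other i i≢0 with inside ct i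
  ... | inj₁ ∈A = ∈A
  ... | inj₂ ≡w = ⊥-elim (i≢0 (inj C _ _ (trans ≡w (sym (through ct)))))

⁅x⁆-atMostOneNeighbour : (G : Graph n) (x : Fin n) → AtMostOneNeighbour G ⁅ x ⁆
⁅x⁆-atMostOneNeighbour G x _ u∈ v∈ _ _ = trans (x∈⁅y⁆⇒x≡y x u∈) (sym (x∈⁅y⁆⇒x≡y x v∈))

module _ {G : Graph m} {X : Graph n} (f : Fin m → Fin n)
         (f-injective : ∀ a b → f a ≡ f b → a ≡ b) (f-adj : ∀ {a b} → Adj G a b → Adj X (f a) (f b)) where

  map-cycle : Cycle G → Cycle X
  map-cycle c = record { k = k c ; vs = f ∘ vs c ; inj = λ i j → inj c i j ∘ f-injective _ _
                       ; steps = f-adj ∘ steps c ; closing = f-adj (closing c) }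

  convex-preimage : ∀ {S} → Convex X S → Convex G (preimage f S)
  convex-preimage convex w (inj₁ w∈) = w∈
  convex-preimage {S} convex w (inj₂ ct) =
    ∈-preimage⁺ (cycle-closed convex (map-cycle (cyc ct)) (cong f (through ct)) members)
    where
    members : ∀ i → (f (vs (cyc ct) i) ∈ S) ⊎ (f (vs (cyc ct) i) ≡ f w)
    members i with inside ct i
    ... | inj₁ ∈pre = inj₁ (∈-preimage⁻ ∈pre)
    ... | inj₂ ≡w   = inj₂ (cong f ≡w)

CccAtMost : Graph n → ℕ → Set
CccAtMost {n} G c = ∀ (S : Subset n) → Convex G S → S ≢ ⊤ → ∣ S ∣ ≤ c

ProperConvexOfSize : Graph n → ℕ → Set
ProperConvexOfSize {n} G c = Σ (Subset n) λ S → Convex G S × S ≢ ⊤ × ∣ S ∣ ≡ c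

OneNeighbourSetOfSize : Graph n → ℕ → Set
OneNeighbourSetOfSize {n} G c = Σ (Subset n) λ A → AtMostOneNeighbour G A × A ≢ ⊤ × ∣ A ∣ ≡ c

ccc≤n∸1 : (G : Graph n) → CccAtMost G (n ∸ 1)
ccc≤n∸1 G P _ P≢⊤ = ∸-monoˡ-≤ 1 (∉⇒∣p∣<n (proj₂ (∃-∉ P≢⊤)))

every-vertex-on-cycle⇒ccc≤n∸2 : (G : Graph n) → (∀ w → Σ (Cycle G) λ c → vs c zero ≡ w) →
                                CccAtMost G (n ∸ 2)
every-vertex-on-cycle⇒ccc≤n∸2 G on-cycle P convex P≢⊤ with ∃-∉ P≢⊤
... | w , w∉P with all? (λ x → (x ∈? P) ⊎-dec (x ≟ w)) | on-cycle w
...   | yes all-in | C , starts = ⊥-elim (w∉P (cycle-closed convex C starts (all-in ∘ vs C)))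
...   | no ¬all-in | _ with ¬∀⟶∃¬ _ _ (λ x → (x ∈? P) ⊎-dec (x ≟ w)) ¬all-in
...     | x , x-out = ∸-monoˡ-≤ 2 (∉∉⇒2+∣p∣≤n (x-out ∘ inj₂) (x-out ∘ inj₁) w∉P)

-- Cartesian products

module _ {G : Graph m} {H : Graph n} where

  π₁ : Fin (m * n) → Fin m
  π₁ = quotient n

  π₂ : Fin (m * n) → Fin n
  π₂ = remainder {m} n

  private
    PairAdj : Fin m × Fin n → Fin m × Fin n → Set
    PairAdj (x , y) (x′ , y′) = (Adj G x x′ × y ≡ y′) ⊎ (x ≡ x′ × Adj H y y′)

    □-adj⁺ : ∀ {x x′ y y′} → PairAdj (x , y) (x′ , y′) → Adj (G □ H) (combine x y) (combine x′ y′)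
    □-adj⁺ {x} {x′} {y} {y′} = subst₂ PairAdj (sym (remQuot-combine x y)) (sym (remQuot-combine x′ y′))

  □-adjˡ : ∀ {x x′ y} → Adj G x x′ → Adj (G □ H) (combine x y) (combine x′ y)
  □-adjˡ xx′ = □-adj⁺ (inj₁ (xx′ , refl))

  □-adjʳ : ∀ {x : Fin m} {y y′} → Adj H y y′ → Adj (G □ H) (combine x y) (combine x y′)
  □-adjʳ yy′ = □-adj⁺ (inj₂ (refl , yy′))

  private
    combine-≢ˡ : ∀ {x x′ : Fin m} {y y′ : Fin n} → x ≢ x′ → combine x y ≢ combine x′ y′
    combine-≢ˡ {x} {x′} {y} {y′} x≢x′ = x≢x′ ∘ combine-injectiveˡ x y x′ y′

    combine-≢ʳ : ∀ {x x′ : Fin m} {y y′ : Fin n} → y ≢ y′ → combine x y ≢ combine x′ y′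
    combine-≢ʳ {x} {x′} {y} {y′} y≢y′ = y≢y′ ∘ combine-injectiveʳ x y x′ y′

    coordinates-injective : ∀ {u v} → π₁ u ≡ π₁ v → π₂ u ≡ π₂ v → u ≡ v
    coordinates-injective {u} {v} q≡ r≡ = begin
      u                               ≡⟨ combine-remQuot {m} n u ⟨
      uncurry combine (remQuot {m} n u) ≡⟨ cong (uncurry combine) (×-≡,≡→≡ (q≡ , r≡)) ⟩
      uncurry combine (remQuot {m} n v) ≡⟨ combine-remQuot {m} n v ⟩
      v                               ∎
      where open ≡-Reasoning

  □-square-closed : ∀ {S} → Convex (G □ H) S → ∀ {x x′ y y′} → Adj G x x′ → Adj H y y′ →
                    combine x y ∈ S → combine x′ y ∈ S → combine x y′ ∈ S → combine x′ y′ ∈ S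
  □-square-closed convex {x} {x′} {y} {y′} xx′ yy′ xy∈ x′y∈ xy′∈ =
    square-closed convex distinct (□-adjʳ (adjSym H yy′)) (□-adjˡ (adjSym G xx′)) (□-adjʳ yy′) (□-adjˡ xx′)
      x′y∈ xy∈ xy′∈
    where
    x′≢x : x′ ≢ x
    x′≢x = Adj⇒≢ G (adjSym G xx′)
    y≢y′ : y ≢ y′
    y≢y′ = Adj⇒≢ H yy′
    distinct : Unique (combine x′ y′ ∷ combine x′ y ∷ combine x y ∷ combine x y′ ∷ [])
    distinct = (combine-≢ʳ (y≢y′ ∘ sym) ∷ combine-≢ˡ x′≢x ∷ combine-≢ˡ x′≢x ∷ [])
             ∷ (combine-≢ˡ x′≢x ∷ combine-≢ˡ x′≢x ∷ [])
             ∷ (combine-≢ʳ y≢y′ ∷ [])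
             ∷ [] ∷ []

  cross⇒full : Connected G → Connected H → ∀ {S} → Convex (G □ H) S → ∀ {a b} →
               (∀ x → combine x b ∈ S) → (∀ y → combine a y ∈ S) → ∀ x y → combine x y ∈ S
  cross⇒full G-connected H-connected {S} convex {a} {b} row col x y =
    walk-transport (λ y → ∀ x → combine x y ∈ S) next-row (H-connected b y) row x
    where
    next-row : ∀ {y y′} → Adj H y y′ → (∀ x → combine x y ∈ S) → ∀ x → combine x y′ ∈ S
    next-row yy′ row x = walk-transport (λ x → combine x _ ∈ S)
      (λ xx′ → □-square-closed convex xx′ yy′ (row _) (row _)) (G-connected a x) (col _)

  private
    row-of : Fin n → Fin m → Fin (m * n)
    row-of b x = combine x b

    column-of : Fin m → Fin n → Fin (m * n)
    column-of = combine

  row : Fin n → Subset (m * n) → Subset m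
  row b = preimage (row-of b)

  column : Fin m → Subset (m * n) → Subset n
  column a = preimage (column-of a)

  row-convex : ∀ {S} b → Convex (G □ H) S → Convex G (row b S)
  row-convex b = convex-preimage (row-of b) (λ x x′ → combine-injectiveˡ x b x′ b) □-adjˡ

  column-convex : ∀ {S} a → Convex (G □ H) S → Convex H (column a S)
  column-convex a = convex-preimage (column-of a) (λ y y′ → combine-injectiveʳ a y a y′) □-adjʳ

  ∣S∣≡∑∣row∣ : ∀ S → ∣ S ∣ ≡ ∑[ b < n ] ∣ row b S ∣
  ∣S∣≡∑∣row∣ S = begin
    ∣ S ∣                                              ≡⟨ ∣p∣≡∑ S ⟩
    ∑[ v < m * n ] 𝟙 (lookup S v)                      ≡⟨ ∑-combine m n (𝟙 ∘ lookup S) ⟩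
    ∑[ a < m ] ∑[ b < n ] 𝟙 (lookup S (combine a b))   ≡⟨ ∑-comm {m} {n} (λ a b → 𝟙 (lookup S (combine a b))) ⟩
    ∑[ b < n ] ∑[ a < m ] 𝟙 (lookup S (combine a b))   ≡⟨ sum-cong-≗ {n} (λ b → ∣preimage∣ (row-of b) S) ⟨
    ∑[ b < n ] ∣ row b S ∣                             ∎
    where open ≡-Reasoning

  ∣S∣≡∑∣column∣ : ∀ S → ∣ S ∣ ≡ ∑[ a < m ] ∣ column a S ∣
  ∣S∣≡∑∣column∣ S = begin
    ∣ S ∣                                              ≡⟨ ∣p∣≡∑ S ⟩
    ∑[ v < m * n ] 𝟙 (lookup S v)                      ≡⟨ ∑-combine m n (𝟙 ∘ lookup S) ⟩
    ∑[ a < m ] ∑[ b < n ] 𝟙 (lookup S (combine a b))   ≡⟨ sum-cong-≗ {m} (λ a → ∣preimage∣ (column-of a) S) ⟨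
    ∑[ a < m ] ∣ column a S ∣                          ∎
    where open ≡-Reasoning

  □-ccc≤ : Connected G → Connected H → CccAtMost G c → ∀ {d} → CccAtMost H d →
           CccAtMost (G □ H) (n * c ⊔ m * d)
  □-ccc≤ {c} G-connected H-connected G-bound {d} H-bound S convex S≢⊤
    with any? (λ b → all? (λ x → combine x b ∈? S)) | any? (λ a → all? (λ y → combine a y ∈? S))
  ... | yes (b , full-row) | yes (a , full-column) =
    ⊥-elim (S≢⊤ (⊆-antisym ⊆⊤ λ {v} _ → subst (_∈ S) (combine-remQuot {m} n v)
      (cross⇒full G-connected H-connected convex full-row full-column _ _)))
  ... | _ | no ¬full-column = begin
    ∣ S ∣                       ≡⟨ ∣S∣≡∑∣column∣ S ⟩
    ∑[ a < m ] ∣ column a S ∣   ≤⟨ ∑-bound (λ a → ∣ column a S ∣) column-bound ⟩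
    m * d                       ≤⟨ m≤n⊔m (n * c) (m * d) ⟩
    n * c ⊔ m * d               ∎
    where
    open ≤-Reasoning
    column-bound : ∀ a → ∣ column a S ∣ ≤ d
    column-bound a = H-bound (column a S) (column-convex a convex)
      λ full → ¬full-column (a , λ y → ∈-preimage⁻ (subst (y ∈_) (sym full) ∈⊤))
  ... | no ¬full-row | _ = begin
    ∣ S ∣                       ≡⟨ ∣S∣≡∑∣row∣ S ⟩
    ∑[ b < n ] ∣ row b S ∣      ≤⟨ ∑-bound (λ b → ∣ row b S ∣) row-bound ⟩
    n * c                       ≤⟨ m≤m⊔n (n * c) (m * d) ⟩
    n * c ⊔ m * d               ∎
    where
    open ≤-Reasoning
    row-bound : ∀ b → ∣ row b S ∣ ≤ c
    row-bound b = G-bound (row b S) (row-convex b convex)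
      λ full → ¬full-row (b , λ x → ∈-preimage⁻ (subst (x ∈_) (sym full) ∈⊤))

  □-atMostOneNeighbourˡ : ∀ {A} → AtMostOneNeighbour G A → AtMostOneNeighbour (G □ H) (preimage π₁ A)
  □-atMostOneNeighbourˡ {A} one {w} w∉ u∈ v∈ wu wv = coordinates-injective
    (one w₁∉A (∈-preimage⁻ u∈) (∈-preimage⁻ v∈) (proj₁ (G-move u∈ wu)) (proj₁ (G-move v∈ wv)))
    (trans (sym (proj₂ (G-move u∈ wu))) (proj₂ (G-move v∈ wv)))
    where
    w₁∉A : π₁ w ∉ A
    w₁∉A = w∉ ∘ ∈-preimage⁺
    G-move : ∀ {u} → u ∈ preimage π₁ A → Adj (G □ H) w u → Adj G (π₁ w) (π₁ u) × π₂ w ≡ π₂ u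
    G-move u∈ (inj₁ move)       = move
    G-move u∈ (inj₂ (w₁≡u₁ , _)) = ⊥-elim (w₁∉A (subst (_∈ A) (sym w₁≡u₁) (∈-preimage⁻ u∈)))

  □-atMostOneNeighbourʳ : ∀ {A} → AtMostOneNeighbour H A → AtMostOneNeighbour (G □ H) (preimage π₂ A)
  □-atMostOneNeighbourʳ {A} one {w} w∉ u∈ v∈ wu wv = coordinates-injective
    (trans (sym (proj₁ (H-move u∈ wu))) (proj₁ (H-move v∈ wv)))
    (one w₂∉A (∈-preimage⁻ u∈) (∈-preimage⁻ v∈) (proj₂ (H-move u∈ wu)) (proj₂ (H-move v∈ wv)))
    where
    w₂∉A : π₂ w ∉ A
    w₂∉A = w∉ ∘ ∈-preimage⁺
    H-move : ∀ {u} → u ∈ preimage π₂ A → Adj (G □ H) w u → π₁ w ≡ π₁ u × Adj H (π₂ w) (π₂ u)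
    H-move u∈ (inj₂ move)       = move
    H-move u∈ (inj₁ (_ , w₂≡u₂)) = ⊥-elim (w₂∉A (subst (_∈ A) (sym w₂≡u₂) (∈-preimage⁻ u∈)))

  ∑-coordinates : (g : Fin m → Fin n → ℕ) → ∑[ v < m * n ] g (π₁ v) (π₂ v) ≡ ∑[ a < m ] ∑[ b < n ] g a b
  ∑-coordinates g = trans (∑-combine m n (λ v → g (π₁ v) (π₂ v)))
    (sum-cong-≗ {m} λ a → sum-cong-≗ {n} λ b → cong (uncurry g) (remQuot-combine a b))

  ∣preimage-π₁∣ : ∀ A → ∣ preimage π₁ A ∣ ≡ n * ∣ A ∣
  ∣preimage-π₁∣ A = begin
    ∣ preimage π₁ A ∣                      ≡⟨ ∣preimage∣ π₁ A ⟩
    ∑[ v < m * n ] 𝟙 (lookup A (π₁ v))     ≡⟨ ∑-coordinates (λ a _ → 𝟙 (lookup A a)) ⟩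
    ∑[ a < m ] ∑[ b < n ] 𝟙 (lookup A a)   ≡⟨ ∑-comm {m} {n} (λ a _ → 𝟙 (lookup A a)) ⟩
    ∑[ b < n ] ∑[ a < m ] 𝟙 (lookup A a)   ≡⟨ ∑-const n (∑[ a < m ] 𝟙 (lookup A a)) ⟩
    n * ∑[ a < m ] 𝟙 (lookup A a)          ≡⟨ cong (n *_) (∣p∣≡∑ A) ⟨
    n * ∣ A ∣                              ∎
    where open ≡-Reasoning

  ∣preimage-π₂∣ : ∀ A → ∣ preimage π₂ A ∣ ≡ m * ∣ A ∣
  ∣preimage-π₂∣ A = begin
    ∣ preimage π₂ A ∣                      ≡⟨ ∣preimage∣ π₂ A ⟩
    ∑[ v < m * n ] 𝟙 (lookup A (π₂ v))     ≡⟨ ∑-coordinates (λ _ b → 𝟙 (lookup A b)) ⟩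
    ∑[ a < m ] ∑[ b < n ] 𝟙 (lookup A b)   ≡⟨ ∑-const m (∑[ b < n ] 𝟙 (lookup A b)) ⟩
    m * ∑[ b < n ] 𝟙 (lookup A b)          ≡⟨ cong (m *_) (∣p∣≡∑ A) ⟨
    m * ∣ A ∣                              ∎
    where open ≡-Reasoning

  □-oneNeighbourSetˡ : Fin n → OneNeighbourSetOfSize G c → OneNeighbourSetOfSize (G □ H) (n * c)
  □-oneNeighbourSetˡ y (A , one , A≢⊤ , ∣A∣≡c) with ∃-∉ A≢⊤
  ... | x , x∉A = preimage π₁ A , □-atMostOneNeighbourˡ one
                , ∉⇒≢⊤ (x∉A ∘ subst (_∈ A) (cong proj₁ (remQuot-combine x y)) ∘ ∈-preimage⁻)
                , trans (∣preimage-π₁∣ A) (cong (n *_) ∣A∣≡c)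

  □-oneNeighbourSetʳ : Fin m → OneNeighbourSetOfSize H c → OneNeighbourSetOfSize (G □ H) (m * c)
  □-oneNeighbourSetʳ x (A , one , A≢⊤ , ∣A∣≡c) with ∃-∉ A≢⊤
  ... | y , y∉A = preimage π₂ A , □-atMostOneNeighbourʳ one
                , ∉⇒≢⊤ (y∉A ∘ subst (_∈ A) (cong proj₂ (remQuot-combine x y)) ∘ ∈-preimage⁻)
                , trans (∣preimage-π₂∣ A) (cong (m *_) ∣A∣≡c)

-- Convexity of the extremal set alone would not suffice: it is the
-- one-neighbour property that lifts to the product.
record CccFactor (G : Graph n) (c : ℕ) : Set where
  field
    connected : Connected G
    extremal  : OneNeighbourSetOfSize G c
    ccc≤      : CccAtMost G c

  some-vertex : Fin n
  some-vertex = proj₁ (∃-∉ (proj₁ (proj₂ (proj₂ extremal))))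

oneNeighbourSet⇒convex : {G : Graph n} → OneNeighbourSetOfSize G c → ProperConvexOfSize G c
oneNeighbourSet⇒convex (A , one , proper , size) = A , atMostOneNeighbour⇒convex one , proper , size

⊔-closed : (P : ℕ → Set) {a b : ℕ} → P a → P b → P (a ⊔ b)
⊔-closed P {a} {b} pa pb with ⊔-sel a b
... | inj₁ ≡a = subst P (sym ≡a) pa
... | inj₂ ≡b = subst P (sym ≡b) pb

□-ccc : {G : Graph m} {H : Graph n} {d : ℕ} → CccFactor G c → CccFactor H d → IsCcc (G □ H) (n * c ⊔ m * d)
□-ccc {G = G} {H} F₁ F₂ =
  ⊔-closed (ProperConvexOfSize (G □ H))
    (oneNeighbourSet⇒convex (□-oneNeighbourSetˡ {G = G} {H} (some-vertex F₂) (extremal F₁)))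
    (oneNeighbourSet⇒convex (□-oneNeighbourSetʳ {G = G} {H} (some-vertex F₁) (extremal F₂))) ,
  □-ccc≤ (connected F₁) (connected F₂) (ccc≤ F₁) (ccc≤ F₂)
  where open CccFactor

-- Complete graphs

K-connected : (m : ℕ) → Connected (K m)
K-connected m x y with x ≟ y
... | yes refl = here
... | no  x≢y  = step x≢y here

K-ccc≤1 : (m : ℕ) → CccAtMost (K m) 1
K-ccc≤1 m P convex P≢⊤ with ∃-∉ P≢⊤
... | w , w∉P = ∣p∣≤1 same
  where
  same : ∀ {x y} → x ∈ P → y ∈ P → x ≡ y
  same {x} {y} x∈P y∈P with x ≟ y
  ... | yes x≡y = x≡y
  ... | no  x≢y = ⊥-elim (w∉P (triangle-closed {G = K m} convex
                    ((w≢ x∈P ∷ w≢ y∈P ∷ []) ∷ (x≢y ∷ []) ∷ [] ∷ []) (w≢ x∈P) x≢y (w≢ y∈P ∘ sym) x∈P y∈P))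
    where
    w≢ : ∀ {z} → z ∈ P → w ≢ z
    w≢ z∈P refl = w∉P z∈P

K-factor : 2 ≤ m → CccFactor (K m) 1
K-factor {m} (s≤s (s≤s _)) = record
  { connected = K-connected m
  ; extremal  = ⁅ zero ⁆ , ⁅x⁆-atMostOneNeighbour (K m) zero , ∉⇒≢⊤ 1∉⁅0⁆ , ∣⁅x⁆∣≡1 {n = m} zero
  ; ccc≤      = K-ccc≤1 m
  }
  where
  1∉⁅0⁆ : suc zero ∉ ⁅ zero ⁆
  1∉⁅0⁆ (there ())

-- Cycle graphs

module _ (k : ℕ) where

  private
    M : ℕ
    M = suc (suc (suc k))

  residue : ℕ → Fin M
  residue t = fromℕ< (m%n<n t M)

  toℕ-residue : ∀ t → toℕ (residue t) ≡ t % M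
  toℕ-residue t = toℕ-fromℕ< (m%n<n t M)

  residue-toℕ : ∀ x → residue (toℕ x) ≡ x
  residue-toℕ x = toℕ-injective (trans (toℕ-residue (toℕ x)) (m<n⇒m%n≡m (toℕ<n x)))

  residue-periodic : ∀ t → residue (M + t) ≡ residue t
  residue-periodic t = toℕ-injective (begin
    toℕ (residue (M + t)) ≡⟨ toℕ-residue (M + t) ⟩
    (M + t) % M           ≡⟨ cong (_% M) (+-comm M t) ⟩
    (t + M) % M           ≡⟨ [m+n]%n≡m%n t M ⟩
    t % M                 ≡⟨ toℕ-residue t ⟨
    toℕ (residue t)       ∎)
    where open ≡-Reasoning

  residue-adj : ∀ t → CycAdj M (residue t) (residue (suc t))
  residue-adj t with m≤n⇒m<n∨m≡n (m%n<n t M)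
  ... | inj₁ 1+r<M = inj₁ (sym (begin
    toℕ (residue (suc t)) ≡⟨ toℕ-residue (suc t) ⟩
    (1 + t) % M           ≡⟨ %-distribˡ-+ 1 t M ⟩
    (1 + t % M) % M       ≡⟨ m<n⇒m%n≡m 1+r<M ⟩
    suc (t % M)           ≡⟨ cong suc (toℕ-residue t) ⟨
    suc (toℕ (residue t)) ∎))
    where open ≡-Reasoning
  ... | inj₂ 1+r≡M = inj₂ (inj₂ (inj₂ (wraps , trans (cong suc (toℕ-residue t)) 1+r≡M)))
    where
    open ≡-Reasoning
    wraps : toℕ (residue (suc t)) ≡ 0
    wraps = begin
      toℕ (residue (suc t)) ≡⟨ toℕ-residue (suc t) ⟩
      (1 + t) % M           ≡⟨ %-distribˡ-+ 1 t M ⟩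
      (1 + t % M) % M       ≡⟨ cong (_% M) 1+r≡M ⟩
      M % M                 ≡⟨ n%n≡0 M ⟩
      0                     ∎

  %-unshift : ∀ (i : Fin M) a → a ≤ M → ((toℕ i + a) % M + (M ∸ a)) % M ≡ toℕ i
  %-unshift i a a≤M = begin
    ((toℕ i + a) % M + (M ∸ a)) % M           ≡⟨ %-distribˡ-+ ((toℕ i + a) % M) (M ∸ a) M ⟩
    ((toℕ i + a) % M % M + (M ∸ a) % M) % M   ≡⟨ cong (λ r → (r + (M ∸ a) % M) % M) (m%n%n≡m%n (toℕ i + a) M) ⟩
    ((toℕ i + a) % M + (M ∸ a) % M) % M       ≡⟨ %-distribˡ-+ (toℕ i + a) (M ∸ a) M ⟨
    (toℕ i + a + (M ∸ a)) % M                 ≡⟨ cong (_% M) (+-assoc (toℕ i) a _) ⟩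
    (toℕ i + (a + (M ∸ a))) % M               ≡⟨ cong (λ r → (toℕ i + r) % M) (m+[n∸m]≡n a≤M) ⟩
    (toℕ i + M) % M                           ≡⟨ [m+n]%n≡m%n (toℕ i) M ⟩
    toℕ i % M                                 ≡⟨ m<n⇒m%n≡m (toℕ<n i) ⟩
    toℕ i                                     ∎
    where open ≡-Reasoning

  Cyc-connected : (h : 3 ≤ M) → Connected (Cyc M h)
  Cyc-connected h = rooted⇒connected _ zero λ y → subst (Walk _ zero) (residue-toℕ y) (from-zero (toℕ y))
    where
    from-zero : ∀ t → Walk (Cyc M h) zero (residue t)
    from-zero zero    = here
    from-zero (suc t) = from-zero t ◅◅ step (residue-adj t) here

  Cyc-rotation : (h : 3 ≤ M) (w : Fin M) → Σ (Cycle (Cyc M h)) λ c → vs c zero ≡ w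
  Cyc-rotation h w = cycle , residue-toℕ w
    where
    rotated : Fin M → Fin M
    rotated i = residue (toℕ i + toℕ w)
    unrotate : ∀ i → (toℕ (rotated i) + (M ∸ toℕ w)) % M ≡ toℕ i
    unrotate i = trans (cong (λ r → (r + (M ∸ toℕ w)) % M) (toℕ-residue (toℕ i + toℕ w)))
                       (%-unshift i (toℕ w) (<⇒≤ (toℕ<n w)))
    rotated-injective : ∀ i j → rotated i ≡ rotated j → i ≡ j
    rotated-injective i j eq =
      toℕ-injective (trans (sym (unrotate i)) (trans (cong (λ x → (toℕ x + (M ∸ toℕ w)) % M) eq) (unrotate j)))
    rotated-step : ∀ (i : Fin (suc (suc k))) → CycAdj M (rotated (inject₁ i)) (rotated (suc i))
    rotated-step i = subst (λ t → CycAdj M (residue (t + toℕ w)) (rotated (suc i))) (sym (toℕ-inject₁ i))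
                       (residue-adj (toℕ i + toℕ w))
    rotated-closing : CycAdj M (rotated (fromℕ (suc (suc k)))) (rotated zero)
    rotated-closing = subst₂ (λ t r → CycAdj M (residue (t + toℕ w)) r)
                        (sym (toℕ-fromℕ (suc (suc k)))) (residue-periodic (toℕ w))
                        (residue-adj (suc (suc k) + toℕ w))
    cycle : Cycle (Cyc M h)
    cycle = record { k = k ; vs = rotated ; inj = rotated-injective
                   ; steps = rotated-step ; closing = rotated-closing }

  neighbour-of-0 : ∀ (u : Fin (suc k)) → CycAdj M zero (suc (suc u)) → suc (toℕ (suc (suc u))) ≡ M
  neighbour-of-0 u (inj₂ (inj₂ (inj₁ (_ , last)))) = last
  neighbour-of-0 u (inj₁ ())
  neighbour-of-0 u (inj₂ (inj₁ ()))
  neighbour-of-0 u (inj₂ (inj₂ (inj₂ (() , _))))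

  neighbour-of-1 : ∀ (u : Fin (suc k)) → CycAdj M (suc zero) (suc (suc u)) → toℕ (suc (suc u)) ≡ 2
  neighbour-of-1 u (inj₁ two) = sym two
  neighbour-of-1 u (inj₂ (inj₁ ()))
  neighbour-of-1 u (inj₂ (inj₂ (inj₁ (() , _))))
  neighbour-of-1 u (inj₂ (inj₂ (inj₂ (() , _))))

  Cyc-path-atMostOneNeighbour : (h : 3 ≤ M) → AtMostOneNeighbour (Cyc M h) (outside ∷ outside ∷ ⊤)
  Cyc-path-atMostOneNeighbour h {zero} _ (there (there _)) (there (there _)) wu wv =
    toℕ-injective (suc-injective (trans (neighbour-of-0 _ wu) (sym (neighbour-of-0 _ wv))))
  Cyc-path-atMostOneNeighbour h {suc zero} _ (there (there _)) (there (there _)) wu wv =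
    toℕ-injective (trans (neighbour-of-1 _ wu) (sym (neighbour-of-1 _ wv)))
  Cyc-path-atMostOneNeighbour h {suc (suc w)} w∉ _ _ _ _ = ⊥-elim (w∉ (there (there ∈⊤)))

Cyc-factor : (h : 3 ≤ n) → CccFactor (Cyc n h) (n ∸ 2)
Cyc-factor h@(s≤s (s≤s (s≤s (z≤n {k})))) = record
  { connected = Cyc-connected k h
  ; extremal  = outside ∷ outside ∷ ⊤ , Cyc-path-atMostOneNeighbour k h
              , ∉⇒≢⊤ {x = zero} (λ ()) , ∣⊤∣≡n (suc k)
  ; ccc≤      = every-vertex-on-cycle⇒ccc≤n∸2 _ (Cyc-rotation k h)
  }

-- Trees

IsLeaf : Graph n → Fin n → Set
IsLeaf G ℓ = ∀ {u v} → Adj G ℓ u → Adj G ℓ v → u ≡ v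

record Path (G : Graph n) (L : ℕ) : Set where
  field
    vertex           : Fin (suc (suc L)) → Fin n
    vertex-injective : ∀ i j → vertex i ≡ vertex j → i ≡ j
    edge             : ∀ (i : Fin (suc L)) → Adj G (vertex (inject₁ i)) (vertex (suc i))
open Path

module _ {G : Graph n} where

  path-length : Path G L → 2 + L ≤ n
  path-length P = injective⇒≤ (vertex-injective P _ _)

  extend : (P : Path G L) → ∀ {y} → Adj G y (vertex P zero) → (∀ i → vertex P i ≢ y) → Path G (suc L)
  extend {L} P {y} y~tip fresh = record
    { vertex           = vertex′
    ; vertex-injective = injective
    ; edge             = λ { zero → y~tip ; (suc i) → edge P i }
    }
    where
    vertex′ : Fin (3 + L) → Fin n
    vertex′ zero    = y
    vertex′ (suc i) = vertex P i
    injective : ∀ i j → vertex′ i ≡ vertex′ j → i ≡ j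
    injective zero    zero    _  = refl
    injective zero    (suc j) eq = ⊥-elim (fresh j (sym eq))
    injective (suc i) zero    eq = ⊥-elim (fresh i eq)
    injective (suc i) (suc j) eq = cong suc (vertex-injective P i j eq)

  chord⇒cycle : (P : Path G L) (j : Fin L) → Adj G (vertex P (suc (suc j))) (vertex P zero) → Cycle G
  chord⇒cycle {L} P j chord = record
    { k = toℕ j ; vs = vertex P ∘ prefix ; inj = λ a b → inject≤-injective _ _ a b ∘ vertex-injective P _ _
    ; steps = step′ ; closing = subst (λ i → Adj G (vertex P i) (vertex P zero)) (sym prefix-last) chord }
    where
    le : suc (toℕ j) ≤ L
    le = toℕ<n j
    prefix : Fin (3 + toℕ j) → Fin (2 + L)
    prefix i = inject≤ i (s≤s (s≤s le))
    step′ : ∀ (i : Fin (2 + toℕ j)) → Adj G (vertex P (prefix (inject₁ i))) (vertex P (prefix (suc i)))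
    step′ i = subst (λ i′ → Adj G (vertex P i′) (vertex P (prefix (suc i)))) (toℕ-injective (begin
      toℕ (inject₁ (inject≤ i (s≤s le))) ≡⟨ toℕ-inject₁ _ ⟩
      toℕ (inject≤ i (s≤s le))           ≡⟨ toℕ-inject≤ i _ ⟩
      toℕ i                              ≡⟨ toℕ-inject₁ i ⟨
      toℕ (inject₁ i)                    ≡⟨ toℕ-inject≤ (inject₁ i) _ ⟨
      toℕ (prefix (inject₁ i))           ∎)) (edge P (inject≤ i (s≤s le)))
      where open ≡-Reasoning
    prefix-last : prefix (fromℕ (2 + toℕ j)) ≡ suc (suc j)
    prefix-last = toℕ-injective
      (trans (toℕ-inject≤ (fromℕ (2 + toℕ j)) (s≤s (s≤s le))) (toℕ-fromℕ (2 + toℕ j)))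

  -- A neighbour of the tip other than the next path vertex either lies further
  -- along the path, closing a cycle, or extends the path.
  leaf-or-longer : ¬ Cycle G → Path G L → (∃ (IsLeaf G)) ⊎ Path G (suc L)
  leaf-or-longer acyclic P with any? (λ y → adj? G (vertex P zero) y ×-dec ¬? (y ≟ vertex P (suc zero)))
  ... | no ¬other = inj₁ (vertex P zero , λ tu tv → trans (back tu) (sym (back tv)))
    where
    back : ∀ {u} → Adj G (vertex P zero) u → u ≡ vertex P (suc zero)
    back {u} tu with u ≟ vertex P (suc zero)
    ... | yes u≡ = u≡
    ... | no  u≢ = ⊥-elim (¬other (u , tu , u≢))
  ... | yes (y , tip~y , y≢next) with any? (λ i → vertex P i ≟ y)
  ...   | no fresh = inj₂ (extend P (adjSym G tip~y) λ i eq → fresh (i , eq))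
  ...   | yes (zero , tip≡y) = ⊥-elim (Adj⇒≢ G tip~y tip≡y)
  ...   | yes (suc zero , next≡y) = ⊥-elim (y≢next (sym next≡y))
  ...   | yes (suc (suc j) , ≡y) =
    ⊥-elim (acyclic (chord⇒cycle P j (subst (λ z → Adj G z (vertex P zero)) (sym ≡y) (adjSym G tip~y))))

  grow-to-leaf : ¬ Cycle G → ∀ fuel → n ≤ fuel + L → Path G L → ∃ (IsLeaf G)
  grow-to-leaf acyclic zero       n≤L P = ⊥-elim (1+n≰n (≤-trans (n≤1+n _) (≤-trans (path-length P) n≤L)))
  grow-to-leaf acyclic (suc fuel) n≤ P with leaf-or-longer acyclic P
  ... | inj₁ leaf = leaf
  ... | inj₂ P′   = grow-to-leaf acyclic fuel (subst (n ≤_) (sym (+-suc fuel _)) n≤) P′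

  leaf-exists : IsTree G → 2 ≤ n → ∃ (IsLeaf G)
  leaf-exists (connected , acyclic) (s≤s (s≤s _)) with connected zero (suc zero)
  ... | step {y = y} 0~y _ = grow-to-leaf acyclic n (≤-reflexive (sym (+-identityʳ n))) edge-path
    where
    edge-path : Path G 0
    edge-path = record
      { vertex           = λ { zero → zero ; (suc zero) → y }
      ; vertex-injective = λ { zero       zero       _  → refl
                             ; zero       (suc zero) eq → ⊥-elim (Adj⇒≢ G 0~y eq)
                             ; (suc zero) zero       eq → ⊥-elim (Adj⇒≢ G 0~y (sym eq))
                             ; (suc zero) (suc zero) _  → refl }
      ; edge             = λ { zero → 0~y }
      }

∁⁅leaf⁆-atMostOneNeighbour : {G : Graph n} {ℓ : Fin n} → IsLeaf G ℓ → AtMostOneNeighbour G (∁ ⁅ ℓ ⁆)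
∁⁅leaf⁆-atMostOneNeighbour {ℓ = ℓ} leaf w∉ _ _ wu wv with x∈⁅y⁆⇒x≡y ℓ (x∉∁p⇒x∈p w∉)
... | refl = leaf wu wv

tree-factor : {T : Graph n} → 2 ≤ n → IsTree T → CccFactor T (n ∸ 1)
tree-factor {n} {T} n≥2 tree with leaf-exists tree n≥2
... | ℓ , leaf = record
  { connected = proj₁ tree
  ; extremal  = ∁ ⁅ ℓ ⁆ , ∁⁅leaf⁆-atMostOneNeighbour {G = T} leaf , ∉⇒≢⊤ (x∈p⇒x∉∁p (x∈⁅x⁆ ℓ))
              , trans (∣∁p∣≡n∸∣p∣ ⁅ ℓ ⁆) (cong (n ∸_) (∣⁅x⁆∣≡1 ℓ))
  ; ccc≤      = ccc≤n∸1 T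
  }

n*[m∸c]≡m*n∸c*n : ∀ m n c → n * (m ∸ c) ≡ m * n ∸ c * n
n*[m∸c]≡m*n∸c*n m n c = trans (*-comm n (m ∸ c)) (*-distribʳ-∸ n m c)

m*[n∸c]≡m*n∸c*m : ∀ m n c → m * (n ∸ c) ≡ m * n ∸ c * m
m*[n∸c]≡m*n∸c*m m n c = trans (*-distribˡ-∸ m n c) (cong (m * n ∸_) (*-comm m c))

n*[m∸1]≡m*n∸n : ∀ m n → n * (m ∸ 1) ≡ m * n ∸ n
n*[m∸1]≡m*n∸n m n = trans (n*[m∸c]≡m*n∸c*n m n 1) (cong (m * n ∸_) (*-identityˡ n))

m*[n∸1]≡m*n∸m : ∀ m n → m * (n ∸ 1) ≡ m * n ∸ m
m*[n∸1]≡m*n∸m m n = trans (m*[n∸c]≡m*n∸c*m m n 1) (cong (m * n ∸_) (*-identityˡ m))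

mainTheorem15 : (∀ (m n : ℕ) → 2 ≤ m → 2 ≤ n →
    IsCcc (K m □ K n) (m ⊔ n))
    × (∀ (m n : ℕ) → 2 ≤ m → (hn : 3 ≤ n) →
    IsCcc (K m □ Cyc n hn) (n ⊔ (m * (n ∸ 2))))
    × (∀ (m n : ℕ) → 2 ≤ m → 2 ≤ n → (T : Graph n) → IsTree T →
    IsCcc (K m □ T) (n ⊔ (m * (n ∸ 1))))
    × (∀ (m n : ℕ) → (hm : 3 ≤ m) → (hn : 3 ≤ n) →
    IsCcc (Cyc m hm □ Cyc n hn) ((m * n ∸ 2 * n) ⊔ (m * n ∸ 2 * m)))
    × (∀ (m n : ℕ) → (hm : 3 ≤ m) → 2 ≤ n → (T : Graph n) → IsTree T →
    IsCcc (Cyc m hm □ T) ((m * n ∸ 2 * n) ⊔ (m * n ∸ m)))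
    × (∀ (m n : ℕ) → 2 ≤ m → 2 ≤ n → (T₁ : Graph m) → IsTree T₁ → (T₂ : Graph n) → IsTree T₂ →
    IsCcc (T₁ □ T₂) ((m * n ∸ n) ⊔ (m * n ∸ m)))
mainTheorem15 =
    (λ m n hm hn → subst (IsCcc _) (trans (cong₂ _⊔_ (*-identityʳ n) (*-identityʳ m)) (⊔-comm n m))
                     (□-ccc (K-factor hm) (K-factor hn)))
  , (λ m n hm hn → subst (IsCcc _) (cong (_⊔ m * (n ∸ 2)) (*-identityʳ n))
                     (□-ccc (K-factor hm) (Cyc-factor hn)))
  , (λ m n hm hn T tree → subst (IsCcc _) (cong (_⊔ m * (n ∸ 1)) (*-identityʳ n))
                            (□-ccc (K-factor hm) (tree-factor hn tree)))
  , (λ m n hm hn → subst (IsCcc _) (cong₂ _⊔_ (n*[m∸c]≡m*n∸c*n m n 2) (m*[n∸c]≡m*n∸c*m m n 2))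
                     (□-ccc (Cyc-factor hm) (Cyc-factor hn)))
  , (λ m n hm hn T tree → subst (IsCcc _) (cong₂ _⊔_ (n*[m∸c]≡m*n∸c*n m n 2) (m*[n∸1]≡m*n∸m m n))
                            (□-ccc (Cyc-factor hm) (tree-factor hn tree)))
  , (λ m n hm hn T₁ tree₁ T₂ tree₂ → subst (IsCcc _) (cong₂ _⊔_ (n*[m∸1]≡m*n∸n m n) (m*[n∸1]≡m*n∸m m n))
                                        (□-ccc (tree-factor hm tree₁) (tree-factor hn tree₂)))
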